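{- Consider the following eight two-vertex Boolean networks $(f_1,f_2)$: $[14,00]$: $f_1=\neg x_1\land x_2,f_2=x_1$; $[15,00]$: $f_1=x_2,f_2=x_1\land\neg x_2$; $[17,00]$: $f_1=x_1\oplus x_2,f_2=x_1$; $[18,00]$: $f_1=x_1\lor x_2,f_2=x_1\land\neg x_2$; $[23,00]$: $f_1=\neg x_1\land x_2,f_2=x_1\lor x_2$; $[24,00]$: $f_1=x_2,f_2=x_1\oplus x_2$; $[26,00]$: $f_1=x_1\oplus x_2,f_2=x_1\lor x_2$; $[27,00]$: $f_1=x_1\lor x_2,f_2=x_1\oplus x_2$. For every delay vector $(\alpha,\beta)$, every MBN built on one of these networks admits a limit cycle which is reached from every configuration except $(0,0)$.
   Context: The MBN built on a two-vertex Boolean network $(f_1,f_2)$ with delay vector $(\alpha,\beta)$ of positive integers has configurations $(\rho,\gamma)$ with $0\le\rho\le\alpha$, $0\le\gamma\le\beta$, underlying Boolean state $x=([\rho\ge1],[\gamma\ge1])$, and dynamics: the first coordinate becomes $\alpha$ if $f_1(x)=1$, else $\max(\rho-1,0)$; the second becomes $\beta$ if $f_2(x)=1$, else $\max(\gamma-1,0)$. A limit cycle is a periodic orbit of length $\ge2$. $\oplus$ is exclusive or. -}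

module Defs where

open import Data.Bool using (Bool; true; false; not; _∧_; _∨_; _xor_; if_then_else_)
open import Data.Nat using (ℕ; zero; suc; _≤_; _≥_; pred)
open import Data.Product using (_×_; _,_; proj₁; proj₂; Σ; ∃; ∃-syntax)
open import Relation.Binary.PropositionalEquality using (_≡_)
open import Relation.Nullary using (¬_)

BN2 : Set
BN2 = (Bool → Bool → Bool) × (Bool → Bool → Bool)

data Net : Set where
  n14 n15 n17 n18 n23 n24 n26 n27 : Net

network : Net → BN2
network n14 = (λ x₁ x₂ → not x₁ ∧ x₂) , (λ x₁ x₂ → x₁)
network n15 = (λ x₁ x₂ → x₂)          , (λ x₁ x₂ → x₁ ∧ not x₂)
network n17 = (λ x₁ x₂ → x₁ xor x₂)   , (λ x₁ x₂ → x₁)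
network n18 = (λ x₁ x₂ → x₁ ∨ x₂)     , (λ x₁ x₂ → x₁ ∧ not x₂)
network n23 = (λ x₁ x₂ → not x₁ ∧ x₂) , (λ x₁ x₂ → x₁ ∨ x₂)
network n24 = (λ x₁ x₂ → x₂)          , (λ x₁ x₂ → x₁ xor x₂)
network n26 = (λ x₁ x₂ → x₁ xor x₂)   , (λ x₁ x₂ → x₁ ∨ x₂)
network n27 = (λ x₁ x₂ → x₁ ∨ x₂)     , (λ x₁ x₂ → x₁ xor x₂)

Config : Set
Config = ℕ × ℕ

Valid : ℕ → ℕ → Config → Set
Valid α β (ρ , γ) = (ρ ≤ α) × (γ ≤ β)

pos : ℕ → Bool
pos zero    = false
pos (suc _) = true

state : Config → Bool × Bool
state (ρ , γ) = pos ρ , pos γ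

step : BN2 → ℕ → ℕ → Config → Config
step (f₁ , f₂) α β (ρ , γ) =
  (if f₁ (pos ρ) (pos γ) then α else pred ρ) ,
  (if f₂ (pos ρ) (pos γ) then β else pred γ)

iterate : (Config → Config) → ℕ → Config → Config
iterate F zero    c = c
iterate F (suc k) c = F (iterate F k c)

OnLimitCycle : (Config → Config) → Config → Set
OnLimitCycle F c = (∃[ p ] (p ≥ 1 × iterate F p c ≡ c)) × ¬ (F c ≡ c)

-- The orbit of c (the cycle through c) is reached from d.
Reaches : (Config → Config) → Config → Config → Set
Reaches F d c = ∃[ k ] ∃[ j ] (iterate F k d ≡ iterate F j c)

-- Every configuration other than (0 , 0) is driven into one fixed configuration c;
-- since F c is again nonzero, F c also returns to c, so c lies on a cycle, which is a
-- limit cycle as F c ≠ c. Attraction is shown by following the orbit explicitly: after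
-- at most two steps it enters a "lane" in which one coordinate is held at its maximum
-- while the other counts down by one per step, and the lane ends in c.
module Submission where

open import Defs
open import Data.Nat using (ℕ; _≥_; zero; suc; s≤s; z≤n)
open import Data.Nat.Properties using (≤-refl)
open import Data.Product using (_×_; _,_; ∃-syntax)
open import Relation.Binary.Construct.Closure.ReflexiveTransitive using (Star; ε; _◅_)
open import Relation.Binary.PropositionalEquality using (_≡_; refl; trans; cong)
open import Relation.Nullary using (¬_)
open import Data.Empty using (⊥-elim)

iterate-suc : (F : Config → Config) (k : ℕ) (c : Config) →
  iterate F (suc k) c ≡ iterate F k (F c)
iterate-suc F zero    c = refl
iterate-suc F (suc k) c = cong F (iterate-suc F k c)

module Orbits (F : Config → Config) where

  _↦_ : Config → Config → Set
  c ↦ d = F c ≡ d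

  _↠_ : Config → Config → Set
  _↠_ = Star _↦_

  ↠⇒iterate : ∀ {c d} → c ↠ d → ∃[ k ] iterate F k c ≡ d
  ↠⇒iterate ε = 0 , refl
  ↠⇒iterate {c} (refl ◅ c↠d) with ↠⇒iterate c↠d
  ... | k , eq = suc k , trans (iterate-suc F k c) eq

  descend : (lane : ℕ → Config) → (∀ k → lane (suc k) ↦ lane k) →
    ∀ k → lane k ↠ lane 0
  descend lane lane-step zero    = ε
  descend lane lane-step (suc k) = lane-step k ◅ descend lane lane-step k

  AttractsAllButOrigin : Config → Set
  AttractsAllButOrigin c = ∀ d → ¬ d ≡ (0 , 0) → d ↠ c

  attractor⇒limitCycle : ∀ {α β c} → Valid α β c → ¬ F c ≡ c → ¬ F c ≡ (0 , 0) →
    AttractsAllButOrigin c →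
    ∃[ c ] (Valid α β c × OnLimitCycle F c ×
      ((d : Config) → Valid α β d → ¬ (d ≡ (0 , 0)) → Reaches F d c))
  attractor⇒limitCycle {c = c} valid notFixed Fc≢0 attracts =
    c , valid , (cycle , notFixed) , reaches
    where
    cycle : ∃[ p ] (p ≥ 1 × iterate F p c ≡ c)
    cycle with ↠⇒iterate (attracts (F c) Fc≢0)
    ... | k , eq = suc k , s≤s z≤n , trans (iterate-suc F k c) eq

    reaches : (d : Config) → Valid _ _ d → ¬ d ≡ (0 , 0) → Reaches F d c
    reaches d _ d≢0 with ↠⇒iterate (attracts d d≢0)
    ... | k , eq = k , 0 , eq

module Attractors (a b : ℕ) where

  A B : ℕ
  A = suc a
  B = suc b

  module N14 where
    open Orbits (step (network n14) A B)

    attracts : AttractsAllButOrigin (0 , B)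
    attracts (zero  , zero)  d≢0 = ⊥-elim (d≢0 refl)
    attracts (zero  , suc g) _   = refl ◅ refl ◅ descend (_, B) (λ _ → refl) a
    attracts (suc r , g)     _   = refl ◅ descend (_, B) (λ _ → refl) r

  module N15 where
    open Orbits (step (network n15) A B)

    -- Both cases are the same step; splitting on r only lets pos r compute.
    fromRight : ∀ r → (r , B) ↠ (A , 0)
    fromRight zero    = refl ◅ descend (A ,_) (λ _ → refl) b
    fromRight (suc r) = refl ◅ descend (A ,_) (λ _ → refl) b

    attracts : AttractsAllButOrigin (A , 0)
    attracts (zero  , zero)  d≢0 = ⊥-elim (d≢0 refl)
    attracts (zero  , suc g) _   = refl ◅ descend (A ,_) (λ _ → refl) g
    attracts (suc r , zero)  _   = refl ◅ fromRight r
    attracts (suc r , suc g) _   = refl ◅ descend (A ,_) (λ _ → refl) g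

  module N17 where
    open Orbits (step (network n17) A B)

    fromTop : ∀ g → (A , g) ↠ (0 , B)
    fromTop zero    = refl ◅ refl ◅ descend (_, B) (λ _ → refl) a
    fromTop (suc g) = refl ◅ descend (_, B) (λ _ → refl) a

    attracts : AttractsAllButOrigin (0 , B)
    attracts (zero  , zero)  d≢0 = ⊥-elim (d≢0 refl)
    attracts (zero  , suc g) _   = refl ◅ fromTop g
    attracts (suc r , zero)  _   = refl ◅ fromTop B
    attracts (suc r , suc g) _   = refl ◅ descend (_, B) (λ _ → refl) r

  module N18 where
    open Orbits (step (network n18) A B)

    attracts : AttractsAllButOrigin (A , 0)
    attracts (zero  , zero)  d≢0 = ⊥-elim (d≢0 refl)
    attracts (zero  , suc g) _   = refl ◅ descend (A ,_) (λ _ → refl) g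
    attracts (suc r , zero)  _   = refl ◅ descend (A ,_) (λ _ → refl) B
    attracts (suc r , suc g) _   = refl ◅ descend (A ,_) (λ _ → refl) g

  module N23 where
    open Orbits (step (network n23) A B)

    attracts : AttractsAllButOrigin (0 , B)
    attracts (zero  , zero)  d≢0 = ⊥-elim (d≢0 refl)
    attracts (zero  , suc g) _   = refl ◅ descend (_, B) (λ _ → refl) A
    attracts (suc r , g)     _   = refl ◅ descend (_, B) (λ _ → refl) r

  module N24 where
    open Orbits (step (network n24) A B)

    -- From (r , B) the second coordinate is reset to B only when r = 0 (0 xor 1 = 1).
    fromRight : ∀ r → (r , B) ↠ (A , 0)
    fromRight zero    = refl ◅ descend (A ,_) (λ _ → refl) B
    fromRight (suc r) = refl ◅ descend (A ,_) (λ _ → refl) b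

    attracts : AttractsAllButOrigin (A , 0)
    attracts (zero  , zero)  d≢0 = ⊥-elim (d≢0 refl)
    attracts (zero  , suc g) _   = refl ◅ descend (A ,_) (λ _ → refl) B
    attracts (suc r , zero)  _   = refl ◅ fromRight r
    attracts (suc r , suc g) _   = refl ◅ descend (A ,_) (λ _ → refl) g

  module N26 where
    open Orbits (step (network n26) A B)

    attracts : AttractsAllButOrigin (0 , B)
    attracts (zero  , zero)  d≢0 = ⊥-elim (d≢0 refl)
    attracts (zero  , suc g) _   = refl ◅ descend (_, B) (λ _ → refl) A
    attracts (suc r , zero)  _   = refl ◅ descend (_, B) (λ _ → refl) A
    attracts (suc r , suc g) _   = refl ◅ descend (_, B) (λ _ → refl) r

  module N27 where
    open Orbits (step (network n27) A B)

    attracts : AttractsAllButOrigin (A , 0)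
    attracts (zero  , zero)  d≢0 = ⊥-elim (d≢0 refl)
    attracts (zero  , suc g) _   = refl ◅ descend (A ,_) (λ _ → refl) B
    attracts (suc r , zero)  _   = refl ◅ descend (A ,_) (λ _ → refl) B
    attracts (suc r , suc g) _   = refl ◅ descend (A ,_) (λ _ → refl) g

open Attractors

proposition8 : (net : Net) (α β : ℕ) → α ≥ 1 → β ≥ 1 →
    ∃[ c ] (Valid α β c × OnLimitCycle (step (network net) α β) c ×
    ((d : Config) → Valid α β d → ¬ (d ≡ (0 , 0)) →
    Reaches (step (network net) α β) d c))
proposition8 n14 (suc a) (suc b) _ _ =
  Orbits.attractor⇒limitCycle _ (z≤n , ≤-refl) (λ ()) (λ ()) (N14.attracts a b)
proposition8 n15 (suc a) (suc b) _ _ =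
  Orbits.attractor⇒limitCycle _ (≤-refl , z≤n) (λ ()) (λ ()) (N15.attracts a b)
proposition8 n17 (suc a) (suc b) _ _ =
  Orbits.attractor⇒limitCycle _ (z≤n , ≤-refl) (λ ()) (λ ()) (N17.attracts a b)
proposition8 n18 (suc a) (suc b) _ _ =
  Orbits.attractor⇒limitCycle _ (≤-refl , z≤n) (λ ()) (λ ()) (N18.attracts a b)
proposition8 n23 (suc a) (suc b) _ _ =
  Orbits.attractor⇒limitCycle _ (z≤n , ≤-refl) (λ ()) (λ ()) (N23.attracts a b)
proposition8 n24 (suc a) (suc b) _ _ =
  Orbits.attractor⇒limitCycle _ (≤-refl , z≤n) (λ ()) (λ ()) (N24.attracts a b)
proposition8 n26 (suc a) (suc b) _ _ =
  Orbits.attractor⇒limitCycle _ (z≤n , ≤-refl) (λ ()) (λ ()) (N26.attracts a b)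
proposition8 n27 (suc a) (suc b) _ _ =
  Orbits.attractor⇒limitCycle _ (≤-refl , z≤n) (λ ()) (λ ()) (N27.attracts a b)
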